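{- Let $\sigma$ be a confined chip configuration on $K_n$ and $v,w\in[n]$ with $\sigma(v)\le\sigma(w)$. Then for all $t\ge0$, $u_t(\sigma,v)\le u_t(\sigma,w)\le u_t(\sigma,v)+1$.
   Context: Parallel chip-firing on $K_n$: $\sigma:[n]\to\mathbb{Z}_{\ge0}$, $r(\sigma)=\#\{v:\sigma(v)\ge n\}$, $U\sigma(v)=\sigma(v)+r(\sigma)$ if $\sigma(v)\le n-1$, $U\sigma(v)=\sigma(v)-n+r(\sigma)$ if $\sigma(v)\ge n$. $u_t(\sigma,v)=\#\{0\le s<t:U^s\sigma(v)\ge n\}$. $\sigma$ is confined if $\sigma(v)\le 2n-1$ for all $v$ and $\max_v\sigma(v)-\min_v\sigma(v)\le n-1$. -}

module Defs where

open import Data.Nat using (ℕ; zero; suc; _+_; _∸_; _≤_; _≤?_)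
open import Data.Fin using (Fin)
open import Data.List using (List; length; filter)
open import Data.List.Base using (allFin)
open import Relation.Nullary using (Dec; yes; no)
open import Data.Product using (_×_)

Config : ℕ → Set
Config n = Fin n → ℕ

r : ∀ {n} → Config n → ℕ
r {n} σ = length (filter (λ v → n ≤? σ v) (allFin n))

U : ∀ {n} → Config n → Config n
U {n} σ v with n ≤? σ v
... | yes _ = (σ v ∸ n) + r σ
... | no  _ = σ v + r σ

iterU : ∀ {n} → ℕ → Config n → Config n
iterU zero    σ = σ
iterU (suc t) σ = U (iterU t σ)

u : ∀ {n} → ℕ → Config n → Fin n → ℕ
u zero    σ v = 0
u {n} (suc t) σ v with n ≤? iterU t σ v
... | yes _ = suc (u t σ v)
... | no  _ = u t σ v

-- σ is confined: σ(v) ≤ 2n-1 for all v, and max σ - min σ ≤ n-1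
-- (equivalently, σ(x) ≤ σ(y) + (n-1) for all x, y).
Confined : ∀ {n} → Config n → Set
Confined {n} σ = (∀ v → σ v ≤ (n + n) ∸ 1) × (∀ x y → σ x ≤ σ y + (n ∸ 1))

-- A firing vertex loses n chips and every vertex gains r chips per step, so
--   U^t σ(x) + n·u_t(σ,x) = σ(x) + R_t   with R_t independent of x.
-- Comparing v and w,  U^t σ(w) + n·u_t(w) = U^t σ(v) + n·u_t(v) + (σ(w) − σ(v)).
-- Confinement is preserved by U, so σ(w) − σ(v) and |U^t σ(w) − U^t σ(v)| are
-- both at most n − 1, which forces u_t(w) − u_t(v) ∈ {0, 1}.
module Submission where

open import Defs
open import Data.Nat using (ℕ; zero; suc; _+_; _*_; _∸_; _≤_; _<_; _≤?_; s≤s⁻¹)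
open import Data.Nat.Properties
open import Data.Nat.Tactic.RingSolver using (solve-∀)
open import Data.Fin using (Fin)
open import Data.List.Base using (allFin)
open import Data.List.Properties using (length-filter; length-tabulate)
open import Data.Product using (_×_; _,_; ∃-syntax; proj₂)
open import Relation.Nullary using (yes; no)
open import Relation.Binary.PropositionalEquality
open import Algebra.Properties.CommutativeSemigroup +-commutativeSemigroup using (xy∙z≈xz∙y)

received : ∀ {n} → ℕ → Config n → ℕ
received zero    σ = 0
received (suc t) σ = received t σ + r (iterU t σ)

iterU-conservation : ∀ {n} t (σ : Config n) x →
                     iterU t σ x + n * u t σ x ≡ σ x + received t σ
iterU-conservation {n} zero σ x = cong (σ x +_) (*-zeroʳ n)
iterU-conservation {n} (suc t) σ x with n ≤? iterU t σ x
... | yes n≤τx = begin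
  iterU t σ x ∸ n + r τ + n * suc (u t σ x)   ≡⟨ regroup (iterU t σ x ∸ n) (r τ) n (u t σ x) ⟩
  (iterU t σ x ∸ n + n) + n * u t σ x + r τ   ≡⟨ cong (λ y → y + n * u t σ x + r τ) (m∸n+n≡m n≤τx) ⟩
  iterU t σ x + n * u t σ x + r τ             ≡⟨ cong (_+ r τ) (iterU-conservation t σ x) ⟩
  σ x + received t σ + r τ                    ≡⟨ +-assoc (σ x) _ _ ⟩
  σ x + received (suc t) σ                    ∎
  where
  open ≡-Reasoning
  τ : Config n
  τ = iterU t σ
  regroup : ∀ a c k j → a + c + k * suc j ≡ a + k + k * j + c
  regroup = solve-∀
... | no _ = begin
  iterU t σ x + r τ + n * u t σ x   ≡⟨ xy∙z≈xz∙y (iterU t σ x) (r τ) _ ⟩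
  iterU t σ x + n * u t σ x + r τ   ≡⟨ cong (_+ r τ) (iterU-conservation t σ x) ⟩
  σ x + received t σ + r τ          ≡⟨ +-assoc (σ x) _ _ ⟩
  σ x + received (suc t) σ          ∎
  where
  open ≡-Reasoning
  τ : Config n
  τ = iterU t σ

r≤n : ∀ {n} (τ : Config n) → r τ ≤ n
r≤n {n} τ = ≤-trans (length-filter (λ v → n ≤? τ v) (allFin n))
                    (≤-reflexive (length-tabulate (λ i → i)))

module _ {m : ℕ} where

  U-residue : (τ : Config (suc m)) → (∀ v → τ v ≤ m + suc m) →
              ∀ x → ∃[ b ] b ≤ m × U τ x ≡ b + r τ
  U-residue τ bounded x with suc m ≤? τ x
  ... | yes _    = τ x ∸ suc m , m≤n+o⇒m∸n≤o (τ x) (suc m) τx≤n+m , refl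
    where
    τx≤n+m : τ x ≤ suc m + m
    τx≤n+m = ≤-trans (bounded x) (≤-reflexive (+-comm m (suc m)))
  ... | no  τx≱n = τ x , s≤s⁻¹ (≰⇒> τx≱n) , refl

  U-confined : (τ : Config (suc m)) → Confined τ → Confined (U τ)
  U-confined τ (bounded , _) = U-bounded , U-spread
    where
    U-bounded : ∀ v → U τ v ≤ m + suc m
    U-bounded v with U-residue τ bounded v
    ... | b , b≤m , eq = ≤-trans (≤-reflexive eq) (+-mono-≤ b≤m (r≤n τ))

    U-spread : ∀ x y → U τ x ≤ U τ y + m
    U-spread x y with U-residue τ bounded x | U-residue τ bounded y
    ... | b , b≤m , eqx | c , _ , eqy = begin
      U τ x        ≡⟨ eqx ⟩
      b + r τ      ≤⟨ +-monoˡ-≤ (r τ) b≤m ⟩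
      m + r τ      ≡⟨ +-comm m (r τ) ⟩
      r τ + m      ≤⟨ +-monoˡ-≤ m (m≤n+m (r τ) c) ⟩
      c + r τ + m  ≡⟨ cong (_+ m) (sym eqy) ⟩
      U τ y + m    ∎
      where open ≤-Reasoning

  iterU-confined : ∀ t (σ : Config (suc m)) → Confined σ → Confined (iterU t σ)
  iterU-confined zero    σ conf = conf
  iterU-confined (suc t) σ conf = U-confined (iterU t σ) (iterU-confined t σ conf)

  firing-difference : ∀ {p q a b δ} → δ ≤ m → p ≤ q + m → q ≤ p + m →
                      q + suc m * b ≡ p + suc m * a + δ → a ≤ b × b ≤ a + 1
  firing-difference {p} {q} {a} {b} {δ} δ≤m p≤q+m q≤p+m eq =
    s≤s⁻¹ (*-cancelˡ-< N a (suc b) (+-cancelˡ-< p _ _ a-bound)) ,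
    ≤-trans (s≤s⁻¹ (*-cancelˡ-< N b (2 + a) (+-cancelˡ-< q _ _ b-bound))) (≤-reflexive (+-comm 1 a))
    where
    open ≤-Reasoning
    N : ℕ
    N = suc m
    a-bound : p + N * a < p + N * suc b
    a-bound = begin-strict
      p + N * a          ≤⟨ m≤m+n _ δ ⟩
      p + N * a + δ      ≡⟨ sym eq ⟩
      q + N * b          ≤⟨ +-monoˡ-≤ (N * b) q≤p+m ⟩
      p + m + N * b      <⟨ +-monoˡ-< (N * b) (+-monoʳ-< p (n<1+n m)) ⟩
      p + N + N * b      ≡⟨ +-assoc p N _ ⟩
      p + (N + N * b)    ≡⟨ cong (p +_) (sym (*-suc N b)) ⟩
      p + N * suc b      ∎
    b-bound : q + N * b < q + N * (2 + a)
    b-bound = begin-strict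
      q + N * b              ≡⟨ eq ⟩
      p + N * a + δ          ≤⟨ +-mono-≤ (+-monoˡ-≤ (N * a) p≤q+m) δ≤m ⟩
      q + m + N * a + m      ≡⟨ gather q m (N * a) ⟩
      q + N * a + (m + m)    <⟨ +-monoʳ-< (q + N * a) (+-mono-< (n<1+n m) (n<1+n m)) ⟩
      q + N * a + (N + N)    ≡⟨ absorb q N a ⟩
      q + N * (2 + a)        ∎
      where
      gather : ∀ x y z → x + y + z + y ≡ x + z + (y + y)
      gather = solve-∀
      absorb : ∀ x k j → x + k * j + (k + k) ≡ x + k * (2 + j)
      absorb = solve-∀

lemma4p4 : (n : ℕ) (σ : Config n) → Confined σ → (v w : Fin n) → σ v ≤ σ w → (t : ℕ) → (u t σ v ≤ u t σ w) × (u t σ w ≤ u t σ v + 1)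
lemma4p4 zero σ conf () w σv≤σw t
lemma4p4 (suc m) σ conf v w σv≤σw t =
  firing-difference (m≤n+o⇒m∸n≤o (σ w) (σ v) (proj₂ conf w v)) (spread v w) (spread w v) balance
  where
  open ≡-Reasoning
  spread : ∀ x y → iterU t σ x ≤ iterU t σ y + m
  spread = proj₂ (iterU-confined t σ conf)
  δ R : ℕ
  δ = σ w ∸ σ v
  R = received t σ
  balance : iterU t σ w + suc m * u t σ w ≡ iterU t σ v + suc m * u t σ v + δ
  balance = begin
    iterU t σ w + suc m * u t σ w   ≡⟨ iterU-conservation t σ w ⟩
    σ w + R                         ≡⟨ cong (_+ R) (sym (m+[n∸m]≡n σv≤σw)) ⟩
    σ v + δ + R                     ≡⟨ xy∙z≈xz∙y (σ v) δ R ⟩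
    σ v + R + δ                     ≡⟨ cong (_+ δ) (sym (iterU-conservation t σ v)) ⟩
    iterU t σ v + suc m * u t σ v + δ ∎
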